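{- For any nominal transition system $\mathbf T$ and states $P,Q$: if $P\stackrel{\cdot}{\sim}_{\mathbf T}Q$ then $P\stackrel{\cdot}{\sim}_{\mathcal S(\mathbf T)}Q$.
   Context: Nominal sets over a countably infinite (possibly sorted) set of names $\mathcal N$: permutations fix all but finitely many names; every element has finite support $\operatorname{supp}$; $a\# X$ means $a\notin\operatorname{supp}(X)$; $[\mathcal P_{\mathrm{fin}}(\mathcal N)]S$ is $\mathcal P_{\mathrm{fin}}(\mathcal N)\times S$ modulo $(N,X)=_\alpha(N',X')$ iff some $\pi$ with $\pi\cdot(N,X)=(N',X')$ fixes every name of $\operatorname{supp}(X)\setminus N$; classes $\langle N\rangle X$. A nominal transition system: nominal sets STATES, PRED, ACT; equivariant $\vdash\subseteq\mathrm{STATES}\times\mathrm{PRED}$; equivariant $\operatorname{bn}$, $\operatorname{bn}(\alpha)$ a finite subset of $\operatorname{supp}(\alpha)$; equivariant $\rightarrow\ \subseteq\mathrm{STATES}\times[\mathcal P_{\mathrm{fin}}(\mathcal N)](\mathrm{ACT}\times\mathrm{STATES})$ with $(P,\langle N\rangle(\alpha,Q))\in\rightarrow$ only if $N=\operatorname{bn}(\alpha)$; $P\xrightarrow{\alpha}P'$ means $(P,\langle\operatorname{bn}(\alpha)\rangle(\alpha,P'))\in\rightarrow$. A bisimulation is a symmetric relation $R$ on states with: $R(P,Q)$ implies (1) $P\vdash\varphi\Rightarrow Q\vdash\varphi$ for all $\varphi$; (2) whenever $\operatorname{bn}(\alpha)\# Q$ and $P\xrightarrow{\alpha}P'$, some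 $Q'$ has $Q\xrightarrow{\alpha}Q'$ and $R(P',Q')$. $\stackrel{\cdot}{\sim}_{\mathbf T}$ is bisimilarity (union of all bisimulations) in $\mathbf T$. $\mathcal S(\mathbf T)$ is the nominal transition system with: $\mathrm{STATES}_{\mathcal S(\mathbf T)}=\mathrm{STATES}_{\mathbf T}$; $\mathrm{ACT}_{\mathcal S(\mathbf T)}=\mathrm{ACT}_{\mathbf T}\uplus\mathrm{PRED}_{\mathbf T}$; $\operatorname{bn}$ as in $\mathbf T$ on $\mathrm{ACT}_{\mathbf T}$ and $\operatorname{bn}(\varphi)=\emptyset$ for $\varphi\in\mathrm{PRED}_{\mathbf T}$; no state predicates hold ($\vdash_{\mathcal S(\mathbf T)}$ is empty); transitions $P\xrightarrow{\alpha}P'$ in $\mathcal S(\mathbf T)$ iff $P\xrightarrow{\alpha}P'$ in $\mathbf T$ (for $\alpha\in\mathrm{ACT}_{\mathbf T}$), and $P\xrightarrow{\varphi}P$ iff $P\vdash_{\mathbf T}\varphi$ (for $\varphi\in\mathrm{PRED}_{\mathbf T}$), with no other $\varphi$-transitions. -}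

module Defs where

open import Data.Nat using (ℕ; _≤_)
open import Data.List using (List; []; _++_; map)
open import Data.List.Membership.Propositional using (_∈_; _∉_)
open import Data.List.Membership.Propositional.Properties using (∈-map⁻; ∈-++⁺ˡ; ∈-++⁺ʳ)
open import Data.List.Relation.Binary.Subset.Propositional using (_⊆_)
open import Data.Product using (Σ; ∃; ∃-syntax; _×_; _,_; proj₁; proj₂)
open import Data.Sum using (_⊎_; inj₁; inj₂)
open import Data.Sum.Properties using (inj₁-injective; inj₂-injective)
open import Data.Empty using (⊥)
open import Function using (_∘_)
open import Relation.Binary.PropositionalEquality
  using (_≡_; refl; sym; trans; cong; subst)

-- Names.  𝒩 is ℕ (countably infinite), possibly sorted: a sorting
-- assigns a sort to each name, with infinitely many names of each sort.
-- (The unsorted case is Sort = ⊤.)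

record Sorting : Set₁ where
  field
    Sort     : Set
    sort     : ℕ → Sort
    infinite : ∀ (s : Sort) (n : ℕ) → ∃[ a ] (n ≤ a × sort a ≡ s)

-- Finite sets of names are lists; equality of finite sets is mutual inclusion.
_≋_ : List ℕ → List ℕ → Set
A ≋ B = A ⊆ B × B ⊆ A

module _ (Σs : Sorting) where
  open Sorting Σs

  record Perm : Set where
    field
      to       : ℕ → ℕ
      from     : ℕ → ℕ
      from-to  : ∀ a → from (to a) ≡ a
      to-from  : ∀ a → to (from a) ≡ a
      dom      : List ℕ
      finite   : ∀ a → a ∉ dom → to a ≡ a
      sorted   : ∀ a → sort (to a) ≡ sort a
  open Perm public

  idP : Perm
  idP = record { to = λ a → a ; from = λ a → a ; from-to = λ _ → refl
               ; to-from = λ _ → refl ; dom = [] ; finite = λ _ _ → refl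
               ; sorted = λ _ → refl }

  _∘P_ : Perm → Perm → Perm
  π ∘P σ = record
    { to = to π ∘ to σ
    ; from = from σ ∘ from π
    ; from-to = λ a → trans (cong (from σ) (from-to π (to σ a))) (from-to σ a)
    ; to-from = λ a → trans (cong (to π) (to-from σ (from π a))) (to-from π a)
    ; dom = dom π ++ dom σ
    ; finite = λ a a∉ → trans (cong (to π) (finite σ a (λ m → a∉ (∈-++⁺ʳ (dom π) m))))
                              (finite π a (λ m → a∉ (∈-++⁺ˡ m)))
    ; sorted = λ a → trans (sorted π (to σ a)) (sorted σ a)
    }

  record Nominal : Set₁ where
    field
      Carrier : Set
      _·_     : Perm → Carrier → Carrier
      ·-id    : ∀ x → idP · x ≡ x
      ·-comp  : ∀ π σ x → (π ∘P σ) · x ≡ π · (σ · x)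
      ·-ext   : ∀ π σ → (∀ a → to π a ≡ to σ a) → ∀ x → π · x ≡ σ · x
      supp    : Carrier → List ℕ
      supp-supports : ∀ x π → (∀ a → a ∈ supp x → to π a ≡ a) → π · x ≡ x
      supp-least    : ∀ x (A : List ℕ)
                      → (∀ π → (∀ a → a ∈ A → to π a ≡ a) → π · x ≡ x)
                      → supp x ⊆ A
  open Nominal public

  Fresh : (X : Nominal) → ℕ → Carrier X → Set
  Fresh X a x = a ∉ supp X x

  -- α-equivalence on P_fin(𝒩) × (A × S), presenting [P_fin(𝒩)](A × S):
  -- (N,(a,s)) =_α (N',(a',s')) iff some π has π·(N,(a,s)) = (N',(a',s'))
  -- and π fixes every name of supp(a,s) ∖ N, where supp(a,s) = supp a ∪ supp s.
  AlphaEq : (A S : Nominal)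
          → List ℕ → Carrier A → Carrier S
          → List ℕ → Carrier A → Carrier S → Set
  AlphaEq A S N a s N' a' s' =
    Σ Perm λ π →
        (map (to π) N ≋ N')
      × (_·_ A π a ≡ a')
      × (_·_ S π s ≡ s')
      × (∀ b → b ∈ (supp A a ++ supp S s) → b ∉ N → to π b ≡ b)

  -- Nominal transition systems.  The transition relation
  -- → ⊆ STATES × [P_fin(𝒩)](ACT × STATES) is given as a relation on
  -- representatives that is closed under α-equivalence.
  record NTS : Set₁ where
    field
      STATES PRED ACT : Nominal
      _⊢_  : Carrier STATES → Carrier PRED → Set
      ⊢-equivariant : ∀ π P φ → P ⊢ φ → _·_ STATES π P ⊢ _·_ PRED π φ
      bn   : Carrier ACT → List ℕ
      bn-equivariant : ∀ π α → bn (_·_ ACT π α) ≋ map (to π) (bn α)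
      bn-supp : ∀ α → bn α ⊆ supp ACT α
      Trans : Carrier STATES → List ℕ → Carrier ACT → Carrier STATES → Set
      Trans-α : ∀ P N α Q N' α' Q' → AlphaEq ACT STATES N α Q N' α' Q'
              → Trans P N α Q → Trans P N' α' Q'
      Trans-equivariant : ∀ π P N α Q → Trans P N α Q
              → Trans (_·_ STATES π P) (map (to π) N) (_·_ ACT π α) (_·_ STATES π Q)
      Trans-bn : ∀ P N α Q → Trans P N α Q → N ≋ bn α

    _⟶[_]_ : Carrier STATES → Carrier ACT → Carrier STATES → Set
    P ⟶[ α ] P' = Trans P (bn α) α P'

  module _ (T : NTS) where
    open NTS T

    record IsBisimulation (R : Carrier STATES → Carrier STATES → Set) : Set where
      field
        symmetric : ∀ P Q → R P Q → R Q P
        preds     : ∀ P Q → R P Q → ∀ φ → P ⊢ φ → Q ⊢ φ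
        steps     : ∀ P Q → R P Q → ∀ α P'
                  → (∀ a → a ∈ bn α → Fresh STATES a Q)
                  → P ⟶[ α ] P'
                  → ∃[ Q' ] (Q ⟶[ α ] Q' × R P' Q')

    Bisimilar : Carrier STATES → Carrier STATES → Set₁
    Bisimilar P Q = ∃[ R ] (IsBisimulation R × R P Q)

  SumN : Nominal → Nominal → Nominal
  SumN A B = record
    { Carrier = Carrier A ⊎ Carrier B
    ; _·_ = act
    ; ·-id = λ { (inj₁ x) → cong inj₁ (·-id A x) ; (inj₂ y) → cong inj₂ (·-id B y) }
    ; ·-comp = λ { π σ (inj₁ x) → cong inj₁ (·-comp A π σ x)
                 ; π σ (inj₂ y) → cong inj₂ (·-comp B π σ y) }
    ; ·-ext = λ { π σ h (inj₁ x) → cong inj₁ (·-ext A π σ h x)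
                ; π σ h (inj₂ y) → cong inj₂ (·-ext B π σ h y) }
    ; supp = sp
    ; supp-supports = λ { (inj₁ x) π h → cong inj₁ (supp-supports A x π h)
                        ; (inj₂ y) π h → cong inj₂ (supp-supports B y π h) }
    ; supp-least = λ { (inj₁ x) L h → supp-least A x L (λ π f → inj₁-injective (h π f))
                     ; (inj₂ y) L h → supp-least B y L (λ π f → inj₂-injective (h π f)) }
    }
    where
      act : Perm → Carrier A ⊎ Carrier B → Carrier A ⊎ Carrier B
      act π (inj₁ x) = inj₁ (_·_ A π x)
      act π (inj₂ y) = inj₂ (_·_ B π y)
      sp : Carrier A ⊎ Carrier B → List ℕ
      sp (inj₁ x) = supp A x
      sp (inj₂ y) = supp B y

  -- The transformation 𝒮(T): state predicates become self-loop actions.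
  module _ (T : NTS) where
    private module T = NTS T
    open T using (STATES; PRED; ACT; _⊢_)

    private
      ACT' : Nominal
      ACT' = SumN ACT PRED

      bn' : Carrier ACT' → List ℕ
      bn' (inj₁ α) = T.bn α
      bn' (inj₂ φ) = []

      Trans' : Carrier STATES → List ℕ → Carrier ACT' → Carrier STATES → Set
      Trans' P N (inj₁ α) Q = T.Trans P N α Q
      Trans' P N (inj₂ φ) Q = P ⊢ φ × Q ≡ P × N ≋ []

      mapEmpty : ∀ (π : Perm) N → N ⊆ [] → map (to π) N ⊆ []
      mapEmpty π N h m with ∈-map⁻ (to π) m
      ... | a , a∈ , _ with h {a} a∈
      ...   | ()

      Trans'-α : ∀ P N α Q N' α' Q' → AlphaEq ACT' STATES N α Q N' α' Q'
               → Trans' P N α Q → Trans' P N' α' Q'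
      Trans'-α P N (inj₁ α) Q N' (inj₁ α') Q' (π , hN , ha , hs , hf) t =
        T.Trans-α P N α Q N' α' Q' (π , hN , inj₁-injective ha , hs , hf) t
      Trans'-α P N (inj₁ α) Q N' (inj₂ φ') Q' (π , hN , () , hs , hf) t
      Trans'-α P N (inj₂ φ) Q N' (inj₁ α') Q' (π , hN , () , hs , hf) t
      Trans'-α P N (inj₂ φ) Q N' (inj₂ φ') Q' (π , (hN₁ , hN₂) , ha , hs , hf)
               (Pφ , Q≡P , (N⊆[] , _)) =
        subst (P ⊢_) φ≡ Pφ , Q'≡P , ((λ m → mapEmpty π N N⊆[] (hN₂ m)) , λ ())
        where
          notN : ∀ b → b ∉ N
          notN b m with N⊆[] m
          ... | ()
          φ≡ : φ ≡ φ'
          φ≡ = trans (sym (supp-supports PRED φ π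
                        (λ b m → hf b (∈-++⁺ˡ m) (notN b))))
                     (inj₂-injective ha)
          Q'≡P : Q' ≡ P
          Q'≡P = trans (sym hs)
                   (trans (supp-supports STATES Q π
                            (λ b m → hf b (∈-++⁺ʳ (supp PRED φ) m) (notN b)))
                          Q≡P)

      Trans'-eq : ∀ π P N α Q → Trans' P N α Q
        → Trans' (_·_ STATES π P) (map (to π) N) (_·_ ACT' π α) (_·_ STATES π Q)
      Trans'-eq π P N (inj₁ α) Q t = T.Trans-equivariant π P N α Q t
      Trans'-eq π P N (inj₂ φ) Q (Pφ , Q≡P , (N⊆[] , _)) =
        T.⊢-equivariant π P φ Pφ , cong (_·_ STATES π) Q≡P ,
        (mapEmpty π N N⊆[] , λ ())

      Trans'-bn : ∀ P N α Q → Trans' P N α Q → N ≋ bn' α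
      Trans'-bn P N (inj₁ α) Q t = T.Trans-bn P N α Q t
      Trans'-bn P N (inj₂ φ) Q (_ , _ , e) = e

      bn'-eq : ∀ π α → bn' (_·_ ACT' π α) ≋ map (to π) (bn' α)
      bn'-eq π (inj₁ α) = T.bn-equivariant π α
      bn'-eq π (inj₂ φ) = (λ ()) , (λ ())

      bn'-supp : ∀ α → bn' α ⊆ supp ACT' α
      bn'-supp (inj₁ α) = T.bn-supp α
      bn'-supp (inj₂ φ) ()

    𝒮 : NTS
    𝒮 = record
      { STATES = STATES
      ; PRED = PRED
      ; ACT = ACT'
      ; _⊢_ = λ _ _ → ⊥
      ; ⊢-equivariant = λ _ _ _ ()
      ; bn = bn'
      ; bn-equivariant = bn'-eq
      ; bn-supp = bn'-supp
      ; Trans = Trans'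
      ; Trans-α = Trans'-α
      ; Trans-equivariant = Trans'-eq
      ; Trans-bn = Trans'-bn
      }

module Submission where

-- Idea: the very same relation witnesses both.  A bisimulation R of T is
-- already a bisimulation of 𝒮(T):
--   * symmetry does not mention the transition system;
--   * the predicate clause is vacuous, since no predicate holds in 𝒮(T);
--   * a transition of 𝒮(T) labelled by an action of T is a transition of T,
--     so it is matched exactly as in T;
--   * a transition of 𝒮(T) labelled by a predicate φ is a self-loop
--     P —φ→ P with P ⊢ φ.  If R P Q then Q ⊢ φ by the predicate clause of
--     R in T, so Q —φ→ Q answers it, and R P Q relates the targets.

open import Defs
open import Data.Product using (∃-syntax; _×_; _,_)
open import Data.Sum using (inj₁; inj₂)
open import Data.List.Membership.Propositional using (_∈_)
open import Relation.Binary.PropositionalEquality using (_≡_; refl)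

module _ (Σs : Sorting) (T : NTS Σs) where
  open NTS T using (STATES; _⊢_)
  private module S = NTS (𝒮 Σs T)

  predicate-step⁻ : ∀ P φ P' → P S.⟶[ inj₂ φ ] P' → P ⊢ φ × P' ≡ P
  predicate-step⁻ P φ P' (Pφ , P'≡P , _) = Pφ , P'≡P

  predicate-step⁺ : ∀ P φ → P ⊢ φ → P S.⟶[ inj₂ φ ] P
  predicate-step⁺ P φ Pφ = Pφ , refl , (λ ()) , (λ ())

  bisimulation-𝒮 : ∀ {R : Carrier STATES → Carrier STATES → Set}
                 → IsBisimulation Σs T R → IsBisimulation Σs (𝒮 Σs T) R
  bisimulation-𝒮 {R} isB = record
    { symmetric = B.symmetric
    ; preds     = λ _ _ _ _ ()
    ; steps     = match
    }
    where
      module B = IsBisimulation isB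

      match : ∀ P Q → R P Q → ∀ α P'
            → (∀ a → a ∈ S.bn α → Fresh Σs STATES a Q)
            → P S.⟶[ α ] P'
            → ∃[ Q' ] (Q S.⟶[ α ] Q' × R P' Q')
      match P Q rPQ (inj₁ α) P' fresh step = B.steps P Q rPQ α P' fresh step
      match P Q rPQ (inj₂ φ) P' _ step with predicate-step⁻ P φ P' step
      ... | Pφ , refl = Q , predicate-step⁺ Q φ (B.preds P Q rPQ φ Pφ) , rPQ

theorem8p2 : (Σs : Sorting) (T : NTS Σs) (P Q : Carrier (NTS.STATES T))
    → Bisimilar Σs T P Q → Bisimilar Σs (𝒮 Σs T) P Q
theorem8p2 Σs T P Q (R , isB , rPQ) = R , bisimulation-𝒮 Σs T isB , rPQ
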